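{- Let $\mathcal{U}$ be a nonprincipal ultrafilter on $\mathbb{N}$. Then $\operatorname{add}(\mathfrak{D}_{\mathrm{fin}},\mathfrak{D})\le\operatorname{cof}(\mathbb{N}^{\mathbb{N}}/\mathcal{U})$.
   Context: $\mathbb{N}^{\mathbb{N}}$ is the set of functions $\mathbb{N}\to\mathbb{N}$; $f\le^* g$ means $f(n)\le g(n)$ for all but finitely many $n$. A subset of $\mathbb{N}^{\mathbb{N}}$ is dominating if it is cofinal in $(\mathbb{N}^{\mathbb{N}},\le^*)$. For finite $F\subseteq\mathbb{N}^{\mathbb{N}}$, $\max(F)(n)=\max\{f(n):f\in F\}$; $Y$ is finitely dominating if $\{\max(F):F\subseteq Y\text{ finite}\}$ is dominating. $\mathfrak{D}_{\mathrm{fin}}$ is the class of subsets of $\mathbb{N}^{\mathbb{N}}$ that are not finitely dominating and $\mathfrak{D}$ the class of subsets that are not dominating; $\operatorname{add}(\mathfrak{D}_{\mathrm{fin}},\mathfrak{D})$ is the minimal cardinality of a family $\mathcal{F}\subseteq\mathfrak{D}_{\mathrm{fin}}$ with $\bigcup\mathcal{F}$ dominating. For a nonprincipal ultrafilter $\mathcal{U}$, $f\le_{\mathcal{U}} g$ means $\{n:f(n)\le g(n)\}\in\mathcal{U}$, and $\operatorname{cof}(\mathbb{N}^{\mathbb{N}}/\mathcal{U})$ is the minimal size of a subset $C\subseteq\mathbb{N}^{\mathbb{N}}$ cofinal in $\mathbb{N}^{\mathbb{N}}$ with respect to $\le_{\mathcal{U}}$. -}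

module Defs where

open import Data.Nat using (ℕ; _≤_; _⊔_)
open import Data.Product using (Σ; ∃; _×_)
open import Data.Sum using (_⊎_)
open import Data.List using (List; foldr; map)
open import Data.List.Relation.Unary.All using (All)
open import Relation.Nullary using (¬_)
open import Data.Empty using (⊥)
open import Data.Unit using (⊤)
open import Relation.Binary.PropositionalEquality using (_≡_)

Baire : Set
Baire = ℕ → ℕ

SubBaire : Set₁
SubBaire = Baire → Set

Subℕ : Set₁
Subℕ = ℕ → Set

_≤*_ : Baire → Baire → Set
f ≤* g = ∃ λ N → ∀ n → N ≤ n → f n ≤ g n

Dominating : SubBaire → Set
Dominating Y = ∀ g → ∃ λ f → Y f × (g ≤* f)

maxL : List Baire → Baire
maxL L n = foldr _⊔_ 0 (map (λ f → f n) L)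

FinitelyDominating : SubBaire → Set
FinitelyDominating Y = ∀ g → ∃ λ (L : List Baire) → All Y L × (g ≤* maxL L)

InDfin : SubBaire → Set
InDfin Y = ¬ FinitelyDominating Y

record NonprincipalUltrafilter : Set₁ where
  field
    U         : Subℕ → Set
    whole        : U (λ _ → ⊤)
    upward       : ∀ {A B : Subℕ} → (∀ n → A n → B n) → U A → U B
    inter        : ∀ {A B : Subℕ} → U A → U B → U (λ n → A n × B n)
    proper       : ¬ U (λ _ → ⊥)
    ultra        : ∀ (A : Subℕ) → U A ⊎ U (λ n → ¬ A n)
    nonprincipal : ∀ (k : ℕ) → ¬ U (λ n → n ≡ k)

_≤U[_]_ : Baire → NonprincipalUltrafilter → Baire → Set
f ≤U[ 𝒰 ] g = NonprincipalUltrafilter.U 𝒰 (λ n → f n ≤ g n)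

CofinalU : NonprincipalUltrafilter → SubBaire → Set
CofinalU 𝒰 C = ∀ g → ∃ λ f → C f × (g ≤U[ 𝒰 ] f)

-- Each c ∈ C yields the ≤_𝒰-downset {f : f ≤_𝒰 c}; since C is cofinal these downsets
-- cover ℕ^ℕ, so their union is dominating.  A downset is not finitely dominating: the
-- maximum of finitely many of its members is still ≤_𝒰 c, and a nonprincipal ultrafilter
-- contains every cofinite set, so ≤* implies ≤_𝒰; hence c + 1 ≤* max F would give the
-- absurd c + 1 ≤_𝒰 c.
module Submission where

open import Defs
open import Data.Product using (Σ; ∃; _×_; _,_)
open import Function using (id)
open import Function.Definitions using (Injective)
open import Relation.Binary.PropositionalEquality using (_≡_)
open import Data.Nat using (zero; suc; _≤_; _<_; z≤n)
open import Data.Nat.Properties using (≤-refl; ≤-trans; ⊔-lub; n≮n; ≤∧≢⇒<; m<1+n⇒m≤n; ≰⇒>)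
open import Data.List using (List; []; _∷_)
open import Data.List.Relation.Unary.All using (All; []; _∷_)
open import Data.Sum using (inj₁; inj₂)
open import Data.Empty using (⊥-elim)
open import Relation.Nullary using (¬_)

module _ (𝒰 : NonprincipalUltrafilter) where
  open NonprincipalUltrafilter 𝒰

  initialSegment∉U : ∀ N → ¬ U (λ n → n < N)
  initialSegment∉U zero    u = proper (upward (λ _ ()) u)
  initialSegment∉U (suc N) u with ultra (λ n → n ≡ N)
  ... | inj₁ ≡N = nonprincipal N ≡N
  ... | inj₂ ≢N = initialSegment∉U N
                    (upward (λ _ (n<1+N , n≢N) → ≤∧≢⇒< (m<1+n⇒m≤n n<1+N) n≢N) (inter u ≢N))

  finalSegment∈U : ∀ N → U (λ n → N ≤ n)
  finalSegment∈U N with ultra (λ n → N ≤ n)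
  ... | inj₁ u = u
  ... | inj₂ u = ⊥-elim (initialSegment∉U N (upward (λ _ → ≰⇒>) u))

  ≤*⇒≤U : ∀ {f g} → f ≤* g → f ≤U[ 𝒰 ] g
  ≤*⇒≤U (N , f≤g) = upward f≤g (finalSegment∈U N)

  ≤U-trans : ∀ {f g h} → f ≤U[ 𝒰 ] g → g ≤U[ 𝒰 ] h → f ≤U[ 𝒰 ] h
  ≤U-trans f≤g g≤h = upward (λ _ (p , q) → ≤-trans p q) (inter f≤g g≤h)

  maxL-≤U : ∀ {c} (L : List Baire) → All (λ f → f ≤U[ 𝒰 ] c) L → maxL L ≤U[ 𝒰 ] c
  maxL-≤U []      []       = upward (λ _ _ → z≤n) whole
  maxL-≤U (_ ∷ L) (p ∷ ps) = upward (λ _ (a , b) → ⊔-lub a b) (inter p (maxL-≤U L ps))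

  suc∘≰U : ∀ c → ¬ (λ n → suc (c n)) ≤U[ 𝒰 ] c
  suc∘≰U c sc≤c = proper (upward (λ n → n≮n (c n)) sc≤c)

  ≤U-downset∈Dfin : ∀ c → InDfin (λ f → f ≤U[ 𝒰 ] c)
  ≤U-downset∈Dfin c finDom =
    let (L , L≤c , sc≤*maxL) = finDom (λ n → suc (c n))
    in suc∘≰U c (≤U-trans (≤*⇒≤U sc≤*maxL) (maxL-≤U L L≤c))

corollary4p3 : (𝒰 : NonprincipalUltrafilter) (C : SubBaire) → CofinalU 𝒰 C →
    Σ Set λ J → Σ (J → Σ Baire C) λ ι → Injective _≡_ _≡_ ι ×
      Σ (J → SubBaire) λ Y → (∀ j → InDfin (Y j)) ×
        Dominating (λ f → ∃ λ j → Y j f)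
corollary4p3 𝒰 C cofinal =
  Σ Baire C , id , id ,
  (λ (c , _) f → f ≤U[ 𝒰 ] c) , (λ (c , _) → ≤U-downset∈Dfin 𝒰 c) ,
  λ g → let (c , Cc , g≤c) = cofinal g in g , ((c , Cc) , g≤c) , (0 , λ _ _ → ≤-refl)
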